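{- Let $\mathbf{t}$ be the Tribonacci word. If $k\ge2$ and $n>\frac{T_k+T_{k-2}-3}{2}$, then $\operatorname{nsc}_{\mathbf{t}}(n)\ge T_k$.
   Context: The Tribonacci word is $\mathbf{t}=\sigma^{\omega}(0)$, the fixed point of $\sigma(0)=01$, $\sigma(1)=02$, $\sigma(2)=0$. Tribonacci numbers: $T_{ -1}=1$, $T_0=1$, $T_1=2$, $T_2=4$, $T_k=T_{k-1}+T_{k-2}+T_{k-3}$ for $k\ge3$. For an infinite word $\mathbf{x}=x_0x_1x_2\cdots$ (indexed from $0$) and $n\ge1$, $\operatorname{nsc}_{\mathbf{x}}(n)=\max\{m\in\mathbb{N}: x_i\cdots x_{i+n-1}\neq x_j\cdots x_{j+n-1}\text{ for all } 0\le i<j\le m-1\}$. -}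

module Defs where

open import Data.Nat using (ℕ; zero; suc; _+_; _<_; _≤_)
open import Data.Fin using (Fin; zero; suc)
open import Data.List using (List; []; _∷_; _++_; concatMap; map; upTo)
open import Relation.Binary.PropositionalEquality using (_≡_)
open import Relation.Nullary using (¬_)
open import Data.Product using (_×_)

Letter : Set
Letter = Fin 3

σ : Letter → List Letter
σ zero = zero ∷ suc zero ∷ []
σ (suc zero) = zero ∷ suc (suc zero) ∷ []
σ (suc (suc zero)) = zero ∷ []

σ* : List Letter → List Letter
σ* = concatMap σ

σIter : ℕ → List Letter
σIter zero = zero ∷ []
σIter (suc k) = σ* (σIter k)

at : List Letter → ℕ → Letter
at [] _ = zero
at (x ∷ xs) zero = x
at (x ∷ xs) (suc i) = at xs i

-- Tribonacci word t = t_0 t_1 t_2 ..., t_i = i-th letter of σ^(i+1)(0)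
-- (σ^k(0) is a prefix of t of length T_k > i, so this is the fixed point σ^ω(0)).
t : ℕ → Letter
t i = at (σIter (suc i)) i

-- Tribonacci numbers T_0 = 1, T_1 = 2, T_2 = 4, T_k = T_{k-1}+T_{k-2}+T_{k-3}
-- (with T_{-1} = 1 this agrees with the paper for all k ≥ 0).
T : ℕ → ℕ
T zero = 1
T (suc zero) = 2
T (suc (suc zero)) = 4
T (suc (suc (suc k))) = T (suc (suc k)) + T (suc k) + T k

factor : {A : Set} → (ℕ → A) → ℕ → ℕ → List A
factor x i n = map (λ k → x (i + k)) (upTo n)

DistinctFactors : {A : Set} → (ℕ → A) → ℕ → ℕ → Set
DistinctFactors x n m = ∀ i j → i < j → j < m → ¬ (factor x i n ≡ factor x j n)

IsNsc : {A : Set} → (ℕ → A) → ℕ → ℕ → Set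
IsNsc x n m = DistinctFactors x n m × (∀ m′ → DistinctFactors x n m′ → m′ ≤ m)

-- Write S_k = T_0 + … + T_{k-1}, so that 2 S_{k-1} + 3 = T_k + T_{k-2}.
-- The heart of the proof is the invariant
--     (LCE)  if i < j < T_k and t agrees with itself at i and j on n
--            letters, then j + n ≤ S_k,
-- proved by induction on k through the substitution σ.  Let φ(a) be the
-- position in t = σ(t) where the image σ(t_a) starts.  Every position is
-- φ(a) or the second letter of a length-2 image σ(t_a), and σ(c) always
-- reads 0 followed by "the letter after c", so an agreement at φ(a), φ(b)
-- can be desubstituted to an agreement at a, b whose image covers it.
-- Since φ(T_k) = T_{k+1} and φ(S_k) + 1 = S_{k+1}, (LCE) at level k lifts
-- to level k + 1.
module Submission where

open import Defs
open import Data.Nat using (ℕ; zero; suc; _+_; _*_; _∸_; _<_; _≤_; z≤n; s≤s; s≤s⁻¹)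
open import Data.Nat.Properties
open import Data.Nat.Tactic.RingSolver using (solve-∀)
open import Data.Fin using (zero; suc)
open import Data.List using (List; []; _∷_; _++_; map; applyUpTo; length)
open import Data.List.Properties using (length-++; ++-assoc; ∷-injective)
open import Relation.Binary.PropositionalEquality
open import Relation.Nullary using (¬_; yes; no)
open import Data.Product using (_×_; _,_; proj₁; proj₂; ∃; Σ)
open import Data.Sum using (_⊎_; inj₁; inj₂)
open import Data.Empty using (⊥-elim)
open import Function using (_∘_)

σ*-++ : ∀ u v → σ* (u ++ v) ≡ σ* u ++ σ* v
σ*-++ []      v = refl
σ*-++ (c ∷ u) v = trans (cong (σ c ++_) (σ*-++ u v)) (sym (++-assoc (σ c) (σ* u) (σ* v)))

σIter-split : ∀ k → σIter (3 + k) ≡ σIter (2 + k) ++ σIter (1 + k) ++ σIter k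
σIter-split zero    = refl
σIter-split (suc k) = begin
  σ* (σIter (3 + k))                                        ≡⟨ cong σ* (σIter-split k) ⟩
  σ* (σIter (2 + k) ++ σIter (1 + k) ++ σIter k)            ≡⟨ σ*-++ (σIter (2 + k)) _ ⟩
  σIter (3 + k) ++ σ* (σIter (1 + k) ++ σIter k)            ≡⟨ cong (σIter (3 + k) ++_) (σ*-++ (σIter (1 + k)) (σIter k)) ⟩
  σIter (3 + k) ++ σIter (2 + k) ++ σIter (1 + k)           ∎
  where open ≡-Reasoning

length-σIter : ∀ k → length (σIter k) ≡ T k
length-σIter zero                = refl
length-σIter (suc zero)          = refl
length-σIter (suc (suc zero))    = refl
length-σIter (suc (suc (suc k))) = begin
  length (σIter (3 + k))                                           ≡⟨ cong length (σIter-split k) ⟩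
  length (σIter (2 + k) ++ σIter (1 + k) ++ σIter k)               ≡⟨ length-++ (σIter (2 + k)) ⟩
  length (σIter (2 + k)) + length (σIter (1 + k) ++ σIter k)       ≡⟨ cong (length (σIter (2 + k)) +_) (length-++ (σIter (1 + k))) ⟩
  length (σIter (2 + k)) + (length (σIter (1 + k)) + length (σIter k))
    ≡⟨ cong₂ _+_ (length-σIter (suc (suc k))) (cong₂ _+_ (length-σIter (suc k)) (length-σIter k)) ⟩
  T (2 + k) + (T (1 + k) + T k)                                    ≡⟨ sym (+-assoc (T (2 + k)) (T (1 + k)) (T k)) ⟩
  T (3 + k)                                                        ∎
  where open ≡-Reasoning

σIter-prefix : ∀ k → ∃ λ r → σIter (suc k) ≡ σIter k ++ r
σIter-prefix zero    = suc zero ∷ [] , refl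
σIter-prefix (suc k) with σIter-prefix k
... | r , e = σ* r , trans (cong σ* e) (σ*-++ (σIter k) r)

at-++ : ∀ w r x → x < length w → at (w ++ r) x ≡ at w x
at-++ (c ∷ w) r zero    _       = refl
at-++ (c ∷ w) r (suc x) (s≤s p) = at-++ w r x p

T-positive : ∀ k → 1 ≤ T k
T-positive zero                = s≤s z≤n
T-positive (suc zero)          = s≤s z≤n
T-positive (suc (suc zero))    = s≤s z≤n
T-positive (suc (suc (suc k))) = ≤-trans (T-positive (suc (suc k))) (≤-trans (m≤m+n _ _) (m≤m+n _ _))

T-increasing : ∀ k → T k < T (suc k)
T-increasing zero                = s≤s (s≤s z≤n)
T-increasing (suc zero)          = s≤s (s≤s (s≤s z≤n))
T-increasing (suc (suc zero))    = s≤s (s≤s (s≤s (s≤s (s≤s z≤n))))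
T-increasing (suc (suc (suc k))) = begin-strict
  T (3 + k)                     ≡⟨ +-comm 0 (T (3 + k)) ⟩
  T (3 + k) + 0                 <⟨ +-monoʳ-< (T (3 + k)) (≤-trans (T-positive (1 + k)) (m≤n+m _ (T (2 + k)))) ⟩
  T (3 + k) + (T (2 + k) + T (1 + k)) ≡⟨ sym (+-assoc (T (3 + k)) (T (2 + k)) (T (1 + k))) ⟩
  T (4 + k)                     ∎
  where open ≤-Reasoning

T-monotone : ∀ k d → T k ≤ T (d + k)
T-monotone k zero    = ≤-refl
T-monotone k (suc d) = ≤-trans (T-monotone k d) (<⇒≤ (T-increasing (d + k)))

index<T : ∀ k → k < T k
index<T zero    = s≤s z≤n
index<T (suc k) = ≤-<-trans (index<T k) (T-increasing k)

at-σIter-stable : ∀ k d x → x < T k → at (σIter (d + k)) x ≡ at (σIter k) x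
at-σIter-stable k zero    x _   = refl
at-σIter-stable k (suc d) x x<T with σIter-prefix (d + k)
... | r , e = begin
  at (σIter (suc d + k)) x      ≡⟨ cong (λ w → at w x) e ⟩
  at (σIter (d + k) ++ r) x     ≡⟨ at-++ (σIter (d + k)) r x x<len ⟩
  at (σIter (d + k)) x          ≡⟨ at-σIter-stable k d x x<T ⟩
  at (σIter k) x                ∎
  where
  open ≡-Reasoning
  x<len : x < length (σIter (d + k))
  x<len = subst (x <_) (sym (length-σIter (d + k))) (<-≤-trans x<T (T-monotone k d))

t-σIter : ∀ K x → x < T K → t x ≡ at (σIter K) x
t-σIter K x x<T = begin
  at (σIter (suc x)) x          ≡⟨ sym (at-σIter-stable (suc x) K x (<-trans (n<1+n x) (index<T (suc x)))) ⟩
  at (σIter (K + suc x)) x      ≡⟨ cong (λ z → at (σIter z) x) (+-comm K (suc x)) ⟩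
  at (σIter (suc x + K)) x      ≡⟨ at-σIter-stable K (suc x) x x<T ⟩
  at (σIter K) x                ∎
  where open ≡-Reasoning


len : Letter → ℕ
len c = length (σ c)

len-cases : ∀ c → len c ≡ 1 ⊎ len c ≡ 2
len-cases zero             = inj₂ refl
len-cases (suc zero)       = inj₂ refl
len-cases (suc (suc zero)) = inj₁ refl

len≥1 : ∀ c → 1 ≤ len c
len≥1 zero             = s≤s z≤n
len≥1 (suc zero)       = s≤s z≤n
len≥1 (suc (suc zero)) = s≤s z≤n

len≤2 : ∀ c → len c ≤ 2
len≤2 zero             = ≤-refl
len≤2 (suc zero)       = ≤-refl
len≤2 (suc (suc zero)) = s≤s z≤n

-- φ a = |σ(t_0 ⋯ t_{a-1})|, the position in t = σ(t) where σ(t_a) begins.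
φ : ℕ → ℕ
φ zero    = 0
φ (suc a) = φ a + len (t a)

φ-list : List Letter → ℕ → ℕ
φ-list _       zero    = 0
φ-list []      (suc a) = 0
φ-list (c ∷ w) (suc a) = len c + φ-list w a

φ-list-step : ∀ w a → a < length w → φ-list w (suc a) ≡ φ-list w a + len (at w a)
φ-list-step (c ∷ w) zero    _       = +-comm (len c) 0
φ-list-step (c ∷ w) (suc a) (s≤s p) =
  trans (cong (len c +_) (φ-list-step w a p)) (sym (+-assoc (len c) (φ-list w a) _))

φ-list-length : ∀ w → φ-list w (length w) ≡ length (σ* w)
φ-list-length []      = refl
φ-list-length (c ∷ w) = trans (cong (len c +_) (φ-list-length w)) (sym (length-++ (σ c)))

φ≡φ-list : ∀ K a → a ≤ T K → φ a ≡ φ-list (σIter K) a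
φ≡φ-list K zero    _   = refl
φ≡φ-list K (suc a) a<T = begin
  φ a + len (t a)                             ≡⟨ cong₂ _+_ (φ≡φ-list K a (<⇒≤ a<T)) (cong len (t-σIter K a a<T)) ⟩
  φ-list (σIter K) a + len (at (σIter K) a)   ≡⟨ sym (φ-list-step (σIter K) a (subst (a <_) (sym (length-σIter K)) a<T)) ⟩
  φ-list (σIter K) (suc a)                    ∎
  where open ≡-Reasoning

-- σ maps the prefix σ^k(0) onto σ^{k+1}(0): φ(T_k) = T_{k+1}.
φ-T : ∀ k → φ (T k) ≡ T (suc k)
φ-T k = begin
  φ (T k)                               ≡⟨ φ≡φ-list k (T k) ≤-refl ⟩
  φ-list (σIter k) (T k)                ≡⟨ cong (φ-list (σIter k)) (sym (length-σIter k)) ⟩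
  φ-list (σIter k) (length (σIter k))   ≡⟨ φ-list-length (σIter k) ⟩
  length (σIter (suc k))                ≡⟨ length-σIter (suc k) ⟩
  T (suc k)                             ∎
  where open ≡-Reasoning

φ-suc : ∀ a → suc (φ a) ≤ φ (suc a)
φ-suc a = ≤-trans (≤-reflexive (+-comm 1 (φ a))) (+-monoʳ-≤ (φ a) (len≥1 (t a)))

φ-monotone : ∀ {a b} → a ≤ b → φ a ≤ φ b
φ-monotone {a} {b} a≤b = ≤-trans (grow (b ∸ a)) (≤-reflexive (cong φ (m∸n+n≡m a≤b)))
  where
  grow : ∀ d → φ a ≤ φ (d + a)
  grow zero    = ≤-refl
  grow (suc d) = ≤-trans (grow d) (m≤m+n (φ (d + a)) _)

φ-reflects-< : ∀ {a b} → φ a < φ b → a < b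
φ-reflects-< {a} {b} φa<φb with a <? b
... | yes a<b = a<b
... | no  a≮b = ⊥-elim (<⇒≱ φa<φb (φ-monotone (≮⇒≥ a≮b)))

Δφ : ℕ → ℕ → ℕ
Δφ a zero    = 0
Δφ a (suc m) = len (t a) + Δφ (suc a) m

φ-+ : ∀ a m → φ (a + m) ≡ φ a + Δφ a m
φ-+ a zero    = trans (cong φ (+-identityʳ a)) (sym (+-identityʳ (φ a)))
φ-+ a (suc m) = trans (cong φ (+-suc a m)) (trans (φ-+ (suc a) m) (+-assoc (φ a) _ _))


-- The second letter of σ(c) (for c = 2 the letter 0 beginning the next image).
next : Letter → Letter
next zero             = suc zero
next (suc zero)       = suc (suc zero)
next (suc (suc zero)) = zero

previous : Letter → Letter
previous zero             = suc (suc zero)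
previous (suc zero)       = zero
previous (suc (suc zero)) = suc zero

previous-next : ∀ c → previous (next c) ≡ c
previous-next zero             = refl
previous-next (suc zero)       = refl
previous-next (suc (suc zero)) = refl

next-injective : ∀ {c d} → next c ≡ next d → c ≡ d
next-injective {c} {d} e = trans (sym (previous-next c)) (trans (cong previous e) (previous-next d))

next-nonzero : ∀ c → len c ≡ 2 → ¬ next c ≡ zero
next-nonzero zero       _ ()
next-nonzero (suc zero) _ ()
next-nonzero (suc (suc zero)) () _

at-σ*-head : ∀ w → at (σ* w) 0 ≡ zero
at-σ*-head []                     = refl
at-σ*-head (zero ∷ w)             = refl
at-σ*-head (suc zero ∷ w)         = refl
at-σ*-head (suc (suc zero) ∷ w)   = refl

image-letters-list : ∀ w a → a < length w →
  at (σ* w) (φ-list w a) ≡ zero × at (σ* w) (suc (φ-list w a)) ≡ next (at w a)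
image-letters-list (zero ∷ w)           zero    _       = refl , refl
image-letters-list (suc zero ∷ w)       zero    _       = refl , refl
image-letters-list (suc (suc zero) ∷ w) zero    _       = refl , at-σ*-head w
image-letters-list (zero ∷ w)           (suc a) (s≤s p) = image-letters-list w a p
image-letters-list (suc zero ∷ w)       (suc a) (s≤s p) = image-letters-list w a p
image-letters-list (suc (suc zero) ∷ w) (suc a) (s≤s p) = image-letters-list w a p

image-letters : ∀ a → t (φ a) ≡ zero × t (suc (φ a)) ≡ next (t a)
image-letters a = first , second
  where
  K = 2 + a
  w = σIter K
  a+2≤T : 2 + a ≤ T K
  a+2≤T = <⇒≤ (index<T K)
  a<T : a < T K
  a<T = <-trans (n<1+n a) a+2≤T
  φa≡ : φ a ≡ φ-list w a
  φa≡ = φ≡φ-list K a (<⇒≤ a<T)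
  second<T : suc (φ a) < T (suc K)
  second<T = ≤-trans (s≤s (φ-suc a)) (≤-trans (φ-suc (suc a))
               (≤-trans (φ-monotone a+2≤T) (≤-reflexive (φ-T K))))
  listed : at (σ* w) (φ-list w a) ≡ zero × at (σ* w) (suc (φ-list w a)) ≡ next (at w a)
  listed = image-letters-list w a (subst (a <_) (sym (length-σIter K)) a<T)
  first : t (φ a) ≡ zero
  first = trans (t-σIter (suc K) (φ a) (<-trans (n<1+n (φ a)) second<T))
                (trans (cong (at (σ* w)) φa≡) (proj₁ listed))
  second : t (suc (φ a)) ≡ next (t a)
  second = trans (t-σIter (suc K) (suc (φ a)) second<T)
             (trans (cong (at (σ* w) ∘ suc) φa≡)
               (trans (proj₂ listed) (cong next (sym (t-σIter K a a<T)))))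

φ-next : ∀ a {ℓ} → len (t a) ≡ ℓ → ℓ + φ a ≡ φ (suc a)
φ-next a {ℓ} p = trans (+-comm ℓ (φ a)) (cong (φ a +_) (sym p))

position-cases : ∀ x → ∃ λ a → x ≡ φ a ⊎ (x ≡ suc (φ a) × len (t a) ≡ 2)
position-cases zero = 0 , inj₁ refl
position-cases (suc x) with position-cases x
... | a , inj₂ (x≡ , ℓ≡2) = suc a , inj₁ (trans (cong suc x≡) (φ-next a ℓ≡2))
... | a , inj₁ x≡ with len-cases (t a)
...   | inj₁ ℓ≡1 = suc a , inj₁ (trans (cong suc x≡) (φ-next a ℓ≡1))
...   | inj₂ ℓ≡2 = a , inj₂ (cong suc x≡ , ℓ≡2)


record Agree (i j n : ℕ) : Set where
  constructor agree
  field at-offset : ∀ r → r < n → t (i + r) ≡ t (j + r)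
open Agree

Agree-empty : ∀ {i j} → Agree i j 0
Agree-empty = agree λ _ ()

Agree-head : ∀ {i j m} → Agree i j (suc m) → t i ≡ t j
Agree-head {i} {j} A =
  trans (cong t (sym (+-identityʳ i))) (trans (at-offset A 0 (s≤s z≤n)) (cong t (+-identityʳ j)))

Agree-tail : ∀ {i j m} → Agree i j (suc m) → Agree (suc i) (suc j) m
Agree-tail {i} {j} A = agree λ r r<m →
  trans (cong t (sym (+-suc i r))) (trans (at-offset A (suc r) (s≤s r<m)) (cong t (+-suc j r)))

Agree-cons : ∀ {i j m} → t i ≡ t j → Agree (suc i) (suc j) m → Agree i j (suc m)
Agree-cons {i} {j} {m} e A = agree extended
  where
  extended : ∀ r → r < suc m → t (i + r) ≡ t (j + r)
  extended zero    _       = trans (cong t (+-identityʳ i)) (trans e (cong t (sym (+-identityʳ j))))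
  extended (suc r) (s≤s p) = trans (cong t (+-suc i r)) (trans (at-offset A r p) (cong t (sym (+-suc j r))))

Agree-restrict : ∀ {i j p q} → q ≤ p → Agree i j p → Agree i j q
Agree-restrict q≤p A = agree λ r r<q → at-offset A r (<-≤-trans r<q q≤p)

Agree-drop : ∀ {i j} p q → Agree i j (p + q) → Agree (i + p) (j + p) q
Agree-drop {i} {j} p q A = agree λ r r<q →
  trans (cong t (+-assoc i p r)) (trans (at-offset A (p + r) (+-monoʳ-< p r<q)) (cong t (sym (+-assoc j p r))))

Agree-join : ∀ {i j} p q → Agree i j p → Agree (i + p) (j + p) q → Agree i j (p + q)
Agree-join {i} {j} p q A B = agree joined
  where
  joined : ∀ r → r < p + q → t (i + r) ≡ t (j + r)
  joined r r<p+q with r <? p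
  ... | yes r<p = at-offset A r r<p
  ... | no  r≮p = trans (cong t (trans (cong (i +_) (sym split)) (sym (+-assoc i p (r ∸ p)))))
                    (trans (at-offset B (r ∸ p) rest<q) (cong t (trans (+-assoc j p (r ∸ p)) (cong (j +_) split))))
    where
    split : p + (r ∸ p) ≡ r
    split = m+[n∸m]≡n (≮⇒≥ r≮p)
    rest<q : r ∸ p < q
    rest<q = +-cancelˡ-< p (r ∸ p) q (≤-<-trans (≤-reflexive split) r<p+q)

factor-agree : ∀ i j n → factor t i n ≡ factor t j n → Agree i j n
factor-agree i j n e = agree (pointwise (λ r → t (i + r)) (λ r → t (j + r)) (λ r → r) n e)
  where
  pointwise : (f g : ℕ → Letter) (h : ℕ → ℕ) → ∀ n → map f (applyUpTo h n) ≡ map g (applyUpTo h n) →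
              ∀ r → r < n → f (h r) ≡ g (h r)
  pointwise f g h (suc n) e zero    _       = proj₁ (∷-injective e)
  pointwise f g h (suc n) e (suc r) (s≤s p) = pointwise f g (h ∘ suc) n (proj₂ (∷-injective e)) r p


image-starts : ∀ a b → t (φ a) ≡ t (φ b)
image-starts a b = trans (proj₁ (image-letters a)) (sym (proj₁ (image-letters b)))

image-heads : ∀ a b → t a ≡ t b → Agree (φ a) (φ b) 2
image-heads a b e = Agree-cons (image-starts a b)
  (Agree-cons (trans (proj₂ (image-letters a)) (trans (cong next e) (sym (proj₂ (image-letters b)))))
    Agree-empty)

preimage-head : ∀ {a b n} → Agree (φ a) (φ b) (suc (suc n)) → t a ≡ t b
preimage-head {a} {b} A = next-injective
  (trans (sym (proj₂ (image-letters a))) (trans (Agree-head (Agree-tail A)) (proj₂ (image-letters b))))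

-- σ maps an agreement of length m to an agreement covering the images, plus the next 0.
substitute : ∀ m a b → Agree a b m → Agree (φ a) (φ b) (suc (Δφ a m))
substitute zero    a b _ = Agree-cons (image-starts a b) Agree-empty
substitute (suc m) a b A =
  subst (Agree (φ a) (φ b)) (+-suc (len (t a)) (Δφ (suc a) m))
    (Agree-join (len (t a)) _ (Agree-restrict (len≤2 (t a)) (image-heads a b e))
      (subst (λ y → Agree (φ (suc a)) y (suc (Δφ (suc a) m))) (cong (λ c → φ b + len c) (sym e))
        (substitute m (suc a) (suc b) (Agree-tail A))))
  where
  e : t a ≡ t b
  e = Agree-head A

-- A preimage of an n-letter agreement at φ a, φ b: an agreement of some length m at a, b
-- whose image (followed by one more letter) covers the n letters.
Preimage : ℕ → ℕ → ℕ → Set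
Preimage a b n = Σ ℕ λ m → Agree a b m × φ b + n ≤ suc (φ (b + m))

preimage-short : ∀ a b n → n ≤ 1 → Preimage a b n
preimage-short a b n n≤1 = 0 , Agree-empty ,
  ≤-trans (+-monoʳ-≤ (φ b) n≤1) (≤-reflexive (trans (+-comm (φ b) 1) (cong (suc ∘ φ) (sym (+-identityʳ b)))))

peel : ∀ {a b q N} → t a ≡ t b → len (t a) + q ≡ N → Agree (φ a) (φ b) N → Agree (φ (suc a)) (φ (suc b)) q
peel {a} {b} {q} e refl A = subst (λ c → Agree (φ (suc a)) (φ b + len c) q) e (Agree-drop (len (t a)) q A)

unpeel : ∀ {a b q N} → t a ≡ t b → len (t a) + q ≡ N → Preimage (suc a) (suc b) q → Preimage a b N
unpeel {a} {b} {q} e refl (m , B , covered) = suc m , Agree-cons e B , (begin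
  φ b + (len (t a) + q)      ≡⟨ cong (λ c → φ b + (len c + q)) e ⟩
  φ b + (len (t b) + q)      ≡⟨ sym (+-assoc (φ b) (len (t b)) q) ⟩
  φ (suc b) + q              ≤⟨ covered ⟩
  suc (φ (suc b + m))        ≡⟨ cong (suc ∘ φ) (sym (+-suc b m)) ⟩
  suc (φ (b + suc m))        ∎)
  where open ≤-Reasoning

-- Desubstitution: every agreement at image positions has a preimage.  After the two
-- letters fixing t_a = t_b, the images of t_a, t_b (of length 1 or 2) are peeled off.
desubstitute : ∀ n a b → Agree (φ a) (φ b) n → Preimage a b n

desubstitute-long : ∀ n a b → 2 ≤ n → Agree (φ a) (φ b) n → len (t a) ≡ 1 ⊎ len (t a) ≡ 2 → Preimage a b n
desubstitute-long (suc (suc n)) a b _ A (inj₁ ℓ≡1) =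
  unpeel {a} {b} e N≡ (desubstitute (suc n) (suc a) (suc b) (peel {a} {b} e N≡ A))
  where
  e : t a ≡ t b
  e = preimage-head {a} {b} A
  N≡ : len (t a) + suc n ≡ suc (suc n)
  N≡ = cong (_+ suc n) ℓ≡1
desubstitute-long (suc (suc n)) a b _ A (inj₂ ℓ≡2) =
  unpeel {a} {b} e N≡ (desubstitute n (suc a) (suc b) (peel {a} {b} e N≡ A))
  where
  e : t a ≡ t b
  e = preimage-head {a} {b} A
  N≡ : len (t a) + n ≡ suc (suc n)
  N≡ = cong (_+ n) ℓ≡2
desubstitute-long (suc zero) _ _ (s≤s ()) _ _

desubstitute zero          a b _ = preimage-short a b 0 z≤n
desubstitute (suc zero)    a b _ = preimage-short a b 1 ≤-refl
desubstitute (suc (suc n)) a b A = desubstitute-long (suc (suc n)) a b (s≤s (s≤s z≤n)) A (len-cases (t a))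


S : ℕ → ℕ
S zero    = 0
S (suc k) = S k + T k

prefix-recurs : ∀ k → Agree 0 (T k) (S k) × suc (φ (S k)) ≡ S (suc k)
prefix-recurs zero    = Agree-empty , refl
prefix-recurs (suc k) with prefix-recurs k
... | A , image≡ = A′ , image≡′
  where
  A′ : Agree 0 (T (suc k)) (S (suc k))
  A′ = subst₂ (Agree 0) (φ-T k) (trans (cong suc (sym (φ-+ 0 (S k)))) image≡) (substitute (S k) 0 (T k) A)
  Δφ-equal : ∀ a b m → Agree a b m → Δφ a m ≡ Δφ b m
  Δφ-equal a b zero    _ = refl
  Δφ-equal a b (suc m) A = cong₂ _+_ (cong len (Agree-head A)) (Δφ-equal (suc a) (suc b) m (Agree-tail A))
  image≡′ : suc (φ (S k + T k)) ≡ S (suc k) + T (suc k)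
  image≡′ = begin
    suc (φ (S k + T k))                    ≡⟨ cong (suc ∘ φ) (+-comm (S k) (T k)) ⟩
    suc (φ (T k + S k))                    ≡⟨ cong suc (φ-+ (T k) (S k)) ⟩
    suc (φ (T k) + Δφ (T k) (S k))         ≡⟨ cong suc (cong₂ _+_ (φ-T k) (sym (Δφ-equal 0 (T k) (S k) A))) ⟩
    suc (T (suc k) + Δφ 0 (S k))           ≡⟨ cong (λ x → suc (T (suc k) + x)) (sym (φ-+ 0 (S k))) ⟩
    suc (T (suc k) + φ (S k))              ≡⟨ cong suc (+-comm (T (suc k)) (φ (S k))) ⟩
    suc (φ (S k)) + T (suc k)              ≡⟨ cong (_+ T (suc k)) image≡ ⟩
    S (suc k) + T (suc k)                  ∎
    where open ≡-Reasoning

T≤1+S : ∀ k → T k ≤ suc (S k)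
T≤1+S zero                = ≤-refl
T≤1+S (suc zero)          = ≤-refl
T≤1+S (suc (suc zero))    = ≤-refl
T≤1+S (suc (suc (suc k))) = begin
  T (2 + k) + T (1 + k) + T k          ≡⟨ rearrange (T k) (T (1 + k)) (T (2 + k)) ⟩
  T k + T (1 + k) + T (2 + k)          ≤⟨ m≤n+m _ (S k) ⟩
  S k + (T k + T (1 + k) + T (2 + k))  ≡⟨ reassociate (S k) (T k) (T (1 + k)) (T (2 + k)) ⟩
  S (3 + k)                            ≤⟨ n≤1+n _ ⟩
  suc (S (3 + k))                      ∎
  where
  open ≤-Reasoning
  rearrange : ∀ a b c → c + b + a ≡ a + b + c
  rearrange = solve-∀
  reassociate : ∀ s a b c → s + (a + b + c) ≡ s + a + b + c
  reassociate = solve-∀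

twice-S : ∀ k → 2 * S (suc k) + 3 ≡ T (suc (suc k)) + T k
twice-S zero    = refl
twice-S (suc k) = trans (split (S (suc k)) (T (suc k)))
  (trans (cong (_+ 2 * T (suc k)) (twice-S k)) (regroup (T (suc (suc k))) (T (suc k)) (T k)))
  where
  split : ∀ s b → 2 * (s + b) + 3 ≡ (2 * s + 3) + 2 * b
  split = solve-∀
  regroup : ∀ a b c → (a + c) + 2 * b ≡ (a + b + c) + b
  regroup = solve-∀


LCE-Bound : ℕ → Set
LCE-Bound k = ∀ i j n → i < j → j < T k → Agree i j n → j + n ≤ S k

image-agreement-bound : ∀ k → LCE-Bound k →
  ∀ a b n → φ a < φ b → φ b < T (suc k) → Agree (φ a) (φ b) n → φ b + n ≤ S (suc k)
image-agreement-bound k lce a b n φa<φb φb<T A with desubstitute n a b A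
... | m , B , covered = begin
  φ b + n               ≤⟨ covered ⟩
  suc (φ (b + m))       ≤⟨ s≤s (φ-monotone (lce a b m (φ-reflects-< φa<φb) b<T B)) ⟩
  suc (φ (S k))         ≡⟨ proj₂ (prefix-recurs k) ⟩
  S (suc k)             ∎
  where
  open ≤-Reasoning
  b<T : b < T k
  b<T = φ-reflects-< (<-≤-trans φb<T (≤-reflexive (sym (φ-T k))))

-- (LCE) lifts from level k to k + 1: positions of t are image starts or second letters
-- of length-2 images (always nonzero), and mixing the two kinds contradicts agreement.
LCE-step : ∀ k → LCE-Bound k → LCE-Bound (suc k)
LCE-step k lce i j zero _ j<T _ = ≤-trans (≤-reflexive (+-identityʳ j)) (s≤s⁻¹ (≤-trans j<T (T≤1+S (suc k))))
LCE-step k lce i j (suc n) i<j j<T A with position-cases i | position-cases j | Agree-head A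
... | a , inj₁ refl | b , inj₁ refl | _ = image-agreement-bound k lce a b (suc n) i<j j<T A
... | a , inj₂ (refl , ℓ≡2) | b , inj₁ refl | e =
  ⊥-elim (next-nonzero (t a) ℓ≡2 (trans (sym (proj₂ (image-letters a))) (trans e (proj₁ (image-letters b)))))
... | a , inj₁ refl | b , inj₂ (refl , ℓ≡2) | e =
  ⊥-elim (next-nonzero (t b) ℓ≡2 (trans (sym (proj₂ (image-letters b))) (trans (sym e) (proj₁ (image-letters a)))))
... | a , inj₂ (refl , _) | b , inj₂ (refl , _) | _ =
  ≤-trans (≤-reflexive (sym (+-suc (φ b) (suc n))))
    (image-agreement-bound k lce a b (suc (suc n)) (s≤s⁻¹ i<j) (<-trans (n<1+n _) j<T)
      (Agree-cons (image-starts a b) A))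

-- (LCE) holds at every level; at level 0 there are no two positions below T_0 = 1.
LCE : ∀ k → LCE-Bound k
LCE zero    _ zero    _ () _         _
LCE zero    _ (suc _) _ _  (s≤s ()) _
LCE (suc k) = LCE-step k (LCE k)

agreement-length-bound : ∀ k i j n → i < j → j < T (suc (suc k)) → Agree i j n → n ≤ S (suc k)
agreement-length-bound k i j n i<j j<T A with j <? T (suc k)
... | yes j<T′ = ≤-trans (m≤n+m n j) (LCE (suc k) i j n i<j j<T′ A)
... | no  j≮T′ = +-cancelʳ-≤ j n (S (suc k)) (begin
  n + j                 ≡⟨ +-comm n j ⟩
  j + n                 ≤⟨ LCE (suc (suc k)) i j n i<j j<T A ⟩
  S (suc k) + T (suc k) ≤⟨ +-monoʳ-≤ (S (suc k)) (≮⇒≥ j≮T′) ⟩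
  S (suc k) + j         ∎)
  where open ≤-Reasoning


-- Theorem 12.  With k ≥ 2 written as k′ + 2, the hypothesis says S_{k′+1} < n, so any two
-- of the first T_k factors of length n would agree on more than S_{k′+1} letters.
mainTheorem12 : ∀ (k n m : ℕ) → 2 ≤ k → T k + T (k ∸ 2) < 2 * n + 3 → IsNsc t n m → T k ≤ m
mainTheorem12 (suc (suc k)) n m (s≤s (s≤s z≤n)) hyp (_ , maximal) = maximal (T (2 + k)) distinct
  where
  S<n : S (suc k) < n
  S<n = *-cancelˡ-< 2 (S (suc k)) n
          (+-cancelʳ-< 3 (2 * S (suc k)) (2 * n) (≤-trans (s≤s (≤-reflexive (twice-S k))) hyp))
  distinct : DistinctFactors t n (T (2 + k))
  distinct i j i<j j<T same =
    <⇒≱ S<n (agreement-length-bound k i j n i<j j<T (factor-agree i j n same))
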